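{- If an $n$-vertex linear $3$-uniform hypergraph $H$ has at least $288\, n\log^2(5n)$ edges, then $H$ contains a loose cycle.
   Context: A $3$-uniform hypergraph is linear if any two distinct edges share at most one vertex. A loose cycle is a cyclic sequence of $\ell\ge 3$ distinct edges $e_1,\dots,e_\ell$ such that cyclically consecutive edges $e_i,e_{i+1}$ share exactly one vertex, these $\ell$ shared vertices are distinct, and non-consecutive edges are disjoint. Here $\log$ denotes the base-$2$ logarithm. -}

module Defs where

open import Data.Nat using (ℕ; zero; suc; _+_; _*_; _^_; _≤_; _<_)
open import Data.Nat.DivMod using (_mod_)
open import Data.Fin using (Fin; toℕ)
open import Data.Fin.Subset using (Subset; _∩_; ∣_∣)
open import Data.List using (List; length)
open import Data.List.Membership.Propositional using (_∈_)
open import Data.List.Relation.Unary.All using (All)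
open import Data.List.Relation.Unary.Unique.Propositional using (Unique)
open import Data.Product using (Σ; ∃; _×_)
open import Relation.Binary.PropositionalEquality using (_≡_; _≢_)
open import Function.Definitions using (Injective)

record Hypergraph3 (n : ℕ) : Set where
  field
    edges   : List (Subset n)
    unique  : Unique edges
    uniform : All (λ e → ∣ e ∣ ≡ 3) edges
open Hypergraph3 public

numEdges : ∀ {n} → Hypergraph3 n → ℕ
numEdges H = length (edges H)

Linear : ∀ {n} → Hypergraph3 n → Set
Linear H = ∀ e f → e ∈ edges H → f ∈ edges H → e ≢ f → ∣ e ∩ f ∣ ≤ 1

next : ∀ {m} → Fin (suc m) → Fin (suc m)
next {m} i = suc (toℕ i) mod suc m

record LooseCycle {n : ℕ} (H : Hypergraph3 n) (m : ℕ) : Set where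
  field
    length≥3   : 3 ≤ suc m
    cyc        : Fin (suc m) → Subset n
    inH        : ∀ i → cyc i ∈ edges H
    distinct   : Injective _≡_ _≡_ cyc
    consec     : ∀ i → ∣ cyc i ∩ cyc (next i) ∣ ≡ 1
    sharedDist : ∀ i j → i ≢ j →
                 ∣ (cyc i ∩ cyc (next i)) ∩ (cyc j ∩ cyc (next j)) ∣ ≡ 0
    nonconsec  : ∀ i j → i ≢ j → j ≢ next i → i ≢ next j →
                 ∣ cyc i ∩ cyc j ∣ ≡ 0

HasLooseCycle : ∀ {n} → Hypergraph3 n → Set
HasLooseCycle H = ∃ λ m → LooseCycle H m

-- |E| ≥ 288 n (log₂ (5n))², encoded exactly without reals (n ≥ 1):
-- log₂(5n) ≤ √(E/(288n))  iff  for every rational p/q (q ≥ 1) with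
-- (p/q)² > E/(288n) we have log₂(5n) < p/q, i.e. (5n)^q < 2^p.
EdgeBound : ℕ → ℕ → Set
EdgeBound n E = ∀ p q → 1 ≤ q → E * (q * q) < 288 * n * (p * p) →
                (5 * n) ^ q < 2 ^ p

{-# OPTIONS --safe #-}
module Submission where

-- The edge bound is far stronger than needed: for p = q = 1 it already gives at
-- least 288 n edges, and a linear 3-graph with more edges than vertices has a
-- loose cycle. Deleting an edge with a vertex that lies in no other edge keeps
-- more edges than covered vertices, so repeated deletion ends in a non-empty
-- family in which every vertex of every edge lies in a second edge. There we grow
-- a loose path p₀, p₁, …, leaving p₀ through a vertex x ∉ p₁ into another edge g.
-- If g misses p₁, p₂, …, then by linearity g has a vertex outside p₀, hence outside
-- the path, and g becomes the new p₀. The covered vertices cannot grow forever, so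
-- eventually g meets some pₐ with a ≥ 1, and for the least such a the edges
-- g, p₀, …, pₐ form a loose cycle.

open import Defs
open import Data.Nat using (ℕ; zero; suc; _+_; _*_; _≤_; _<_; z≤n; s≤s; >-nonZero)
open import Data.Nat.Properties
open import Data.Nat.DivMod using (_%_; m<n⇒m%n≡m; n%n≡0)
open import Data.Fin using (Fin; toℕ)
open import Data.Fin.Properties using (toℕ-fromℕ<; toℕ≤pred[n]; toℕ-injective; any?; all?; ¬∀⟶∃¬)
  renaming (_≟_ to _≟ᶠ_)
open import Data.Fin.Subset using (Subset; _∩_; _∪_; ∣_∣; ⋃; _⊆_; _⊂_; Nonempty; Empty)
  renaming (_∈_ to _∈ₛ_; _∉_ to _∉ₛ_; ⊥ to ∅)
open import Data.Fin.Subset.Properties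
  using (_∈?_; nonempty?; p⊆q⇒∣p∣≤∣q∣; p⊂q⇒∣p∣<∣q∣; ∣p∣≤n; ∣⊥∣≡0; Empty-unique; ∣⁅x⁆∣≡1; x∈⁅y⁆⇒x≡y;
         x∈p∩q⁺; x∈p∩q⁻; q⊆p∪q; x∈p∪q⁻; x∈p∪q⁺; x∈p⇒∣p-x∣<∣p∣; x∈p∧x≢y⇒x∈p-y; ∉⊥)
open import Data.List using (List; []; _∷_; length; filter)
open import Data.List.Properties using (filter-accept; filter-reject; filter-all)
open import Data.List.Membership.Propositional using (_∈_; find; lose)
open import Data.List.Membership.Propositional.Properties using (∈-filter⁻)
open import Data.List.Relation.Unary.Any using (Any; here; there)
import Data.List.Relation.Unary.Any as Any
import Data.List.Relation.Unary.All as All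
open import Data.List.Relation.Unary.All.Properties using (¬All⇒Any¬)
open import Data.List.Relation.Unary.AllPairs using (_∷_)
open import Data.List.Relation.Unary.Unique.Propositional using (Unique)
import Data.List.Relation.Unary.Unique.Propositional.Properties as Unique
open import Data.Vec.Properties using (≡-dec)
import Data.Bool.Properties as Bool
open import Data.Product using (∃; ∃₂; _×_; _,_; proj₁; proj₂)
open import Data.Sum using (_⊎_; inj₁; inj₂; [_,_])
open import Data.Empty using (⊥; ⊥-elim)
open import Function using (_∘_; case_of_)
open import Relation.Nullary using (¬_; Dec; yes; no; ¬?; _×-dec_; _→-dec_; contradiction)
open import Relation.Nullary.Decidable using (decidable-stable)
open import Relation.Binary.PropositionalEquality
  using (_≡_; _≢_; refl; sym; trans; cong; subst; subst₂; ≢-sym; module ≡-Reasoning)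

open ≡-Reasoning

private variable
  n m : ℕ

-- Sets of vertices and lists of edges

_≟ₛ_ : (p q : Subset n) → Dec (p ≡ q)
_≟ₛ_ = ≡-dec Bool._≟_

Meet : Subset n → Subset n → Set
Meet p q = ∃ λ x → x ∈ₛ p × x ∈ₛ q

x∈p⇒1≤∣p∣ : ∀ {p : Subset n} {x} → x ∈ₛ p → 1 ≤ ∣ p ∣
x∈p⇒1≤∣p∣ {p = p} {x} x∈p = subst (_≤ ∣ p ∣) (∣⁅x⁆∣≡1 x)
  (p⊆q⇒∣p∣≤∣q∣ λ y∈⁅x⁆ → subst (_∈ₛ p) (sym (x∈⁅y⁆⇒x≡y x y∈⁅x⁆)) x∈p)

∣p∣≤1⇒x≡y : ∀ {p : Subset n} {x y} → ∣ p ∣ ≤ 1 → x ∈ₛ p → y ∈ₛ p → x ≡ y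
∣p∣≤1⇒x≡y {x = x} {y} ∣p∣≤1 x∈p y∈p with y ≟ᶠ x
... | yes y≡x = sym y≡x
... | no y≢x = contradiction
  (≤-trans (s≤s (x∈p⇒1≤∣p∣ (x∈p∧x≢y⇒x∈p-y y∈p y≢x))) (≤-trans (x∈p⇒∣p-x∣<∣p∣ x∈p) ∣p∣≤1))
  λ { (s≤s ()) }

Empty⇒∣p∣≡0 : ∀ {p : Subset n} → Empty p → ∣ p ∣ ≡ 0
Empty⇒∣p∣≡0 {n} empty = trans (cong ∣_∣ (Empty-unique empty)) (∣⊥∣≡0 n)

1≤∣p∣⇒Nonempty : ∀ {p : Subset n} → 1 ≤ ∣ p ∣ → Nonempty p
1≤∣p∣⇒Nonempty {p = p} 1≤∣p∣ with nonempty? p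
... | yes nonempty = nonempty
... | no empty = contradiction (Empty⇒∣p∣≡0 empty) (≢-sym (<⇒≢ 1≤∣p∣))

∣p∩q∣<∣p∣⇒∃∈∉ : ∀ (p q : Subset n) → ∣ p ∩ q ∣ < ∣ p ∣ → ∃ λ x → x ∈ₛ p × x ∉ₛ q
∣p∩q∣<∣p∣⇒∃∈∉ p q ∣p∩q∣<∣p∣ with any? (λ x → x ∈? p ×-dec ¬? (x ∈? q))
... | yes found = found
... | no none = contradiction (p⊆q⇒∣p∣≤∣q∣ p⊆p∩q) (<⇒≱ ∣p∩q∣<∣p∣)
  where
  p⊆p∩q : p ⊆ p ∩ q
  p⊆p∩q {x} x∈p = x∈p∩q⁺ (x∈p , decidable-stable (x ∈? q) λ x∉q → none (x , x∈p , x∉q))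

∈-⋃⁺ : ∀ {L : List (Subset n)} {g x} → g ∈ L → x ∈ₛ g → x ∈ₛ ⋃ L
∈-⋃⁺ (here refl) x∈g = x∈p∪q⁺ (inj₁ x∈g)
∈-⋃⁺ (there g∈L) x∈g = x∈p∪q⁺ (inj₂ (∈-⋃⁺ g∈L x∈g))

∣q∣<∣p∪q∣ : ∀ {p q : Subset n} {x} → x ∈ₛ p → x ∉ₛ q → ∣ q ∣ < ∣ p ∪ q ∣
∣q∣<∣p∪q∣ {p = p} {q} {x} x∈p x∉q = p⊂q⇒∣p∣<∣q∣ (q⊆p∪q p q , x , x∈p∪q⁺ (inj₁ x∈p) , x∉q)

-- Out of range the lookup returns ∅, so a vertex of L ‼ a certifies a < length L.
_‼_ : List (Subset n) → ℕ → Subset n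
[] ‼ _ = ∅
(e ∷ L) ‼ zero = e
(e ∷ L) ‼ suc a = L ‼ a

‼-< : ∀ (L : List (Subset n)) a {x} → x ∈ₛ L ‼ a → a < length L
‼-< [] a x∈∅ = ⊥-elim (∉⊥ x∈∅)
‼-< (e ∷ L) zero _ = s≤s z≤n
‼-< (e ∷ L) (suc a) x∈ = s≤s (‼-< L a x∈)

‼-∈ : ∀ (L : List (Subset n)) a → a < length L → L ‼ a ∈ L
‼-∈ (e ∷ L) zero _ = here refl
‼-∈ (e ∷ L) (suc a) (s≤s a<∣L∣) = there (‼-∈ L a a<∣L∣)

∈-⋃⁻ : ∀ (L : List (Subset n)) {x} → x ∈ₛ ⋃ L → ∃ λ a → x ∈ₛ L ‼ a
∈-⋃⁻ [] x∈∅ = ⊥-elim (∉⊥ x∈∅)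
∈-⋃⁻ (e ∷ L) x∈⋃ with x∈p∪q⁻ e (⋃ L) x∈⋃
... | inj₁ x∈e = 0 , x∈e
... | inj₂ x∈⋃L = let a , x∈ = ∈-⋃⁻ L x∈⋃L in suc a , x∈

firstMeeting : (g : Subset n) (T : List (Subset n)) →
  (∀ a → ¬ Meet g (T ‼ a)) ⊎ ∃ λ a → Meet g (T ‼ a) × (∀ b → b < a → ¬ Meet g (T ‼ b))
firstMeeting g [] = inj₁ λ { _ (_ , _ , x∈∅) → ∉⊥ x∈∅ }
firstMeeting g (t ∷ T) with any? (λ x → x ∈? g ×-dec x ∈? t)
... | yes meet = inj₂ (0 , meet , λ _ ())
... | no ¬meet with firstMeeting g T
...   | inj₁ never = inj₁ λ { zero → ¬meet ; (suc a) → never a }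
...   | inj₂ (a , meet , before) =
        inj₂ (suc a , meet , λ { zero _ → ¬meet ; (suc b) (s≤s b<a) → before b b<a })

≢? : (e g : Subset n) → Dec (g ≢ e)
≢? e g = ¬? (g ≟ₛ e)

without : Subset n → List (Subset n) → List (Subset n)
without e = filter (≢? e)

∈-without⁻ : ∀ {e g} (L : List (Subset n)) → g ∈ without e L → g ∈ L × g ≢ e
∈-without⁻ {e = e} L = ∈-filter⁻ (≢? e) {xs = L}

length-without : ∀ {e} {L : List (Subset n)} → Unique L → e ∈ L → length L ≡ suc (length (without e L))
length-without {e = e} {h ∷ t} (h≢t ∷ _) (here refl) =
  cong (suc ∘ length) (sym (trans (filter-reject (≢? e) λ h≢h → h≢h refl)
                       (filter-all (≢? e) (All.map ≢-sym h≢t))))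
length-without {e = e} {h ∷ t} (h≢t ∷ unique) (there e∈t) = begin
  suc (length t)                    ≡⟨ cong suc (length-without unique e∈t) ⟩
  suc (suc (length (without e t)))  ≡⟨ cong (suc ∘ length) (filter-accept (≢? e) (All.lookup h≢t e∈t)) ⟨
  suc (length (without e (h ∷ t)))  ∎

InAnotherEdge : List (Subset n) → Subset n → Fin n → Set
InAnotherEdge L e x = Any (λ g → g ≢ e × x ∈ₛ g) L

NoPendantVertex : List (Subset n) → Set
NoPendantVertex L = ∀ {e x} → e ∈ L → x ∈ₛ e → InAnotherEdge L e x

inAnotherEdge? : ∀ (L : List (Subset n)) e x → Dec (InAnotherEdge L e x)
inAnotherEdge? L e x = Any.any? (λ g → ≢? e g ×-dec x ∈? g) L

noPendantVertexIn? : ∀ (L : List (Subset n)) e → Dec (∀ x → x ∈ₛ e → InAnotherEdge L e x)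
noPendantVertexIn? L e = all? λ x → x ∈? e →-dec inAnotherEdge? L e x

pendantVertex? : ∀ (L : List (Subset n)) →
  NoPendantVertex L ⊎ ∃₂ λ e x → e ∈ L × x ∈ₛ e × ¬ InAnotherEdge L e x
pendantVertex? {n} L with All.all? (noPendantVertexIn? L) L
... | yes none = inj₁ λ e∈L x∈e → All.lookup none e∈L _ x∈e
... | no ¬none with find (¬All⇒Any¬ (noPendantVertexIn? L) L ¬none)
...   | e , e∈L , ¬∀ with ¬∀⟶∃¬ n _ (λ x → x ∈? e →-dec inAnotherEdge? L e x) ¬∀
...     | x , ¬[x∈e⇒another] = inj₂ (e , x , e∈L ,
          decidable-stable (x ∈? e) (λ x∉e → ¬[x∈e⇒another] (⊥-elim ∘ x∉e)) ,
          λ another → ¬[x∈e⇒another] λ _ → another)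

⋃-without-⊂ : ∀ {L : List (Subset n)} {e x} → e ∈ L → x ∈ₛ e → ¬ InAnotherEdge L e x →
  ⋃ (without e L) ⊂ ⋃ L
⋃-without-⊂ {L = L} {e} {x} e∈L x∈e lonely = ⋃-mono , x , ∈-⋃⁺ e∈L x∈e , x∉
  where
  ∈-⋃-without⁻ : ∀ {y} → y ∈ₛ ⋃ (without e L) → ∃ λ g → (g ∈ L × g ≢ e) × y ∈ₛ g
  ∈-⋃-without⁻ y∈ = let a , y∈g = ∈-⋃⁻ (without e L) y∈ in
    _ , ∈-without⁻ L (‼-∈ (without e L) a (‼-< (without e L) a y∈g)) , y∈g

  ⋃-mono : ⋃ (without e L) ⊆ ⋃ L
  ⋃-mono y∈ = let _ , (g∈L , _) , y∈g = ∈-⋃-without⁻ y∈ in ∈-⋃⁺ g∈L y∈g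

  x∉ : x ∉ₛ ⋃ (without e L)
  x∉ x∈ = let _ , (g∈L , g≢e) , x∈g = ∈-⋃-without⁻ x∈ in lonely (lose g∈L (g≢e , x∈g))

-- Indices of a cycle

toℕ-next-< : ∀ (i : Fin (suc m)) → toℕ i < m → toℕ (next i) ≡ suc (toℕ i)
toℕ-next-< i i<m = trans (toℕ-fromℕ< _) (m<n⇒m%n≡m (s≤s i<m))

toℕ-next-last : ∀ (i : Fin (suc m)) → toℕ i ≡ m → toℕ (next i) ≡ 0
toℕ-next-last {m} i i≡m = trans (toℕ-fromℕ< _) (trans (cong (λ a → suc a % suc m) i≡m) (n%n≡0 (suc m)))

toℕ-next : ∀ (i : Fin (suc m)) →
  toℕ i < m × toℕ (next i) ≡ suc (toℕ i) ⊎ toℕ i ≡ m × toℕ (next i) ≡ 0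
toℕ-next i with m≤n⇒m<n∨m≡n (toℕ≤pred[n] i)
... | inj₁ i<m = inj₁ (i<m , toℕ-next-< i i<m)
... | inj₂ i≡m = inj₂ (i≡m , toℕ-next-last i i≡m)

next≢id : 1 ≤ m → (i : Fin (suc m)) → next i ≢ i
next≢id 1≤m i nᵢ≡i with toℕ-next i
... | inj₁ (_ , nᵢ≡1+i) = 1+n≢n (trans (sym nᵢ≡1+i) (cong toℕ nᵢ≡i))
... | inj₂ (i≡m , nᵢ≡0) = <⇒≢ 1≤m (trans (sym nᵢ≡0) (trans (cong toℕ nᵢ≡i) i≡m))

next∘next≢id : 2 ≤ m → (i : Fin (suc m)) → next (next i) ≢ i
next∘next≢id 2≤m i nnᵢ≡i with toℕ-next i | toℕ-next (next i)
... | inj₁ (_ , nᵢ≡1+i) | inj₁ (_ , nnᵢ≡1+nᵢ) = <⇒≢ (m<n⇒m<1+n (n<1+n _)) (begin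
  toℕ i                  ≡⟨ cong toℕ nnᵢ≡i ⟨
  toℕ (next (next i))    ≡⟨ nnᵢ≡1+nᵢ ⟩
  suc (toℕ (next i))     ≡⟨ cong suc nᵢ≡1+i ⟩
  suc (suc (toℕ i))      ∎)
... | inj₁ (_ , nᵢ≡1+i) | inj₂ (nᵢ≡m , nnᵢ≡0) = <⇒≢ 2≤m (begin
  1                          ≡⟨ cong suc nnᵢ≡0 ⟨
  suc (toℕ (next (next i)))  ≡⟨ cong (suc ∘ toℕ) nnᵢ≡i ⟩
  suc (toℕ i)                ≡⟨ nᵢ≡1+i ⟨
  toℕ (next i)               ≡⟨ nᵢ≡m ⟩
  _                          ∎)
... | inj₂ (i≡m , nᵢ≡0) | inj₁ (_ , nnᵢ≡1+nᵢ) = <⇒≢ 2≤m (begin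
  1                      ≡⟨ cong suc nᵢ≡0 ⟨
  suc (toℕ (next i))     ≡⟨ nnᵢ≡1+nᵢ ⟨
  toℕ (next (next i))    ≡⟨ cong toℕ nnᵢ≡i ⟩
  toℕ i                  ≡⟨ i≡m ⟩
  _                      ∎)
... | inj₂ (_ , nᵢ≡0) | inj₂ (nᵢ≡m , _) = <⇒≢ (≤-trans (s≤s z≤n) 2≤m) (trans (sym nᵢ≡0) nᵢ≡m)

Adjacent : ℕ → ℕ → Set
Adjacent a b = a ≡ b ⊎ b ≡ suc a ⊎ a ≡ suc b

Adjacent-sym : ∀ {a b} → Adjacent a b → Adjacent b a
Adjacent-sym (inj₁ a≡b) = inj₁ (sym a≡b)
Adjacent-sym (inj₂ (inj₁ b≡1+a)) = inj₂ (inj₂ b≡1+a)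
Adjacent-sym (inj₂ (inj₂ a≡1+b)) = inj₂ (inj₁ a≡1+b)

Adjacent-suc : ∀ {a b} → Adjacent a b → Adjacent (suc a) (suc b)
Adjacent-suc (inj₁ a≡b) = inj₁ (cong suc a≡b)
Adjacent-suc (inj₂ (inj₁ b≡1+a)) = inj₂ (inj₁ (cong suc b≡1+a))
Adjacent-suc (inj₂ (inj₂ a≡1+b)) = inj₂ (inj₂ (cong suc a≡1+b))

Adjacent-triangle : ∀ {a b c} → a ≢ b → b ≢ c → a ≢ c →
  Adjacent a b → Adjacent b c → Adjacent a c → ⊥
Adjacent-triangle a≢b _ _ (inj₁ a≡b) _ _ = a≢b a≡b
Adjacent-triangle _ b≢c _ _ (inj₁ b≡c) _ = b≢c b≡c
Adjacent-triangle _ _ a≢c _ _ (inj₁ a≡c) = a≢c a≡c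
Adjacent-triangle _ _ _ (inj₂ (inj₁ refl)) (inj₂ (inj₁ refl)) (inj₂ (inj₁ ()))
Adjacent-triangle _ _ _ (inj₂ (inj₁ refl)) (inj₂ (inj₁ refl)) (inj₂ (inj₂ ()))
Adjacent-triangle _ _ a≢c (inj₂ (inj₁ refl)) (inj₂ (inj₂ refl)) _ = a≢c refl
Adjacent-triangle _ _ a≢c (inj₂ (inj₂ refl)) (inj₂ (inj₁ refl)) _ = a≢c refl
Adjacent-triangle _ _ _ (inj₂ (inj₂ refl)) (inj₂ (inj₂ refl)) (inj₂ (inj₁ ()))
Adjacent-triangle _ _ _ (inj₂ (inj₂ refl)) (inj₂ (inj₂ refl)) (inj₂ (inj₂ ()))

CyclicAdjacentℕ : ℕ → ℕ → ℕ → Set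
CyclicAdjacentℕ m a b = Adjacent a b ⊎ a ≡ 0 × b ≡ m ⊎ a ≡ m × b ≡ 0

CyclicAdjacentℕ-sym : ∀ {a b} → CyclicAdjacentℕ m a b → CyclicAdjacentℕ m b a
CyclicAdjacentℕ-sym (inj₁ adj) = inj₁ (Adjacent-sym adj)
CyclicAdjacentℕ-sym (inj₂ (inj₁ (a≡0 , b≡m))) = inj₂ (inj₂ (b≡m , a≡0))
CyclicAdjacentℕ-sym (inj₂ (inj₂ (a≡m , b≡0))) = inj₂ (inj₁ (b≡0 , a≡m))

CyclicAdjacent : Fin (suc m) → Fin (suc m) → Set
CyclicAdjacent i j = i ≡ j ⊎ j ≡ next i ⊎ i ≡ next j

CyclicAdjacentℕ⇒CyclicAdjacent : ∀ {i j : Fin (suc m)} →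
  CyclicAdjacentℕ m (toℕ i) (toℕ j) → CyclicAdjacent i j
CyclicAdjacentℕ⇒CyclicAdjacent (inj₁ (inj₁ i≡j)) = inj₁ (toℕ-injective i≡j)
CyclicAdjacentℕ⇒CyclicAdjacent {m} {i} {j} (inj₁ (inj₂ (inj₁ j≡1+i))) =
  inj₂ (inj₁ (toℕ-injective (trans j≡1+i (sym (toℕ-next-< i (subst (_≤ m) j≡1+i (toℕ≤pred[n] j)))))))
CyclicAdjacentℕ⇒CyclicAdjacent {m} {i} {j} (inj₁ (inj₂ (inj₂ i≡1+j))) =
  inj₂ (inj₂ (toℕ-injective (trans i≡1+j (sym (toℕ-next-< j (subst (_≤ m) i≡1+j (toℕ≤pred[n] i)))))))
CyclicAdjacentℕ⇒CyclicAdjacent {j = j} (inj₂ (inj₁ (i≡0 , j≡m))) =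
  inj₂ (inj₂ (toℕ-injective (trans i≡0 (sym (toℕ-next-last j j≡m)))))
CyclicAdjacentℕ⇒CyclicAdjacent {i = i} (inj₂ (inj₂ (i≡m , j≡0))) =
  inj₂ (inj₁ (toℕ-injective (trans j≡0 (sym (toℕ-next-last i i≡m)))))

-- Loose paths and loose cycles

module _ {n} (H : Hypergraph3 n) (linear : Linear H) where

  ∣e∣≡3 : ∀ {e} → e ∈ edges H → ∣ e ∣ ≡ 3
  ∣e∣≡3 = All.lookup (uniform H)

  shared-vertex-unique : ∀ {e f x y} → e ∈ edges H → f ∈ edges H → e ≢ f →
    x ∈ₛ e → x ∈ₛ f → y ∈ₛ e → y ∈ₛ f → x ≡ y
  shared-vertex-unique e∈H f∈H e≢f x∈e x∈f y∈e y∈f =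
    ∣p∣≤1⇒x≡y (linear _ _ e∈H f∈H e≢f) (x∈p∩q⁺ (x∈e , x∈f)) (x∈p∩q⁺ (y∈e , y∈f))

  private-vertex : ∀ {e f} → e ∈ edges H → f ∈ edges H → e ≢ f → ∃ λ x → x ∈ₛ e × x ∉ₛ f
  private-vertex {e} {f} e∈H f∈H e≢f = ∣p∩q∣<∣p∣⇒∃∈∉ e f
    (≤-<-trans (linear e f e∈H f∈H e≢f) (subst (1 <_) (sym (∣e∣≡3 e∈H)) (s≤s (s≤s z≤n))))

  looseCycle : 2 ≤ m → (c : Fin (suc m) → Subset n) → (∀ i → c i ∈ edges H) →
    (∀ i → Meet (c i) (c (next i))) →
    (∀ i j x → x ∈ₛ c i → x ∈ₛ c j → CyclicAdjacent i j) →
    (∀ i j k x → i ≢ j → j ≢ k → i ≢ k → x ∈ₛ c i → x ∈ₛ c j → x ∈ₛ c k → ⊥) →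
    LooseCycle H m
  looseCycle 2≤m c c∈H meet-next adjacent triangle-free = record
    { length≥3   = s≤s 2≤m
    ; cyc        = c
    ; inH        = c∈H
    ; distinct   = injective
    ; consec     = consec
    ; sharedDist = sharedDist
    ; nonconsec  = nonconsec
    }
    where
    i≢nᵢ : ∀ i → i ≢ next i
    i≢nᵢ i = next≢id (≤-trans (s≤s z≤n) 2≤m) i ∘ sym

    -- Every distinctness condition of a loose cycle follows from: no vertex lies in three of its edges.
    no-repeat : ∀ i j → i ≢ j → i ≢ next j → c i ≢ c j
    no-repeat i j i≢j i≢nⱼ cᵢ≡cⱼ = let x , x∈cⱼ , x∈cₙⱼ = meet-next j in
      triangle-free i j (next j) x i≢j (i≢nᵢ j) i≢nⱼ (subst (x ∈ₛ_) (sym cᵢ≡cⱼ) x∈cⱼ) x∈cⱼ x∈cₙⱼ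

    injective : ∀ {i j} → c i ≡ c j → i ≡ j
    injective {i} {j} cᵢ≡cⱼ with i ≟ᶠ j | i ≟ᶠ next j
    ... | yes i≡j | _ = i≡j
    ... | no i≢j | no i≢nⱼ = ⊥-elim (no-repeat i j i≢j i≢nⱼ cᵢ≡cⱼ)
    ... | no i≢j | yes refl =
          ⊥-elim (no-repeat j (next j) (≢-sym i≢j) (next∘next≢id 2≤m j ∘ sym) (sym cᵢ≡cⱼ))

    consec : ∀ i → ∣ c i ∩ c (next i) ∣ ≡ 1
    consec i = ≤-antisym (linear _ _ (c∈H i) (c∈H (next i)) (i≢nᵢ i ∘ injective))
                         (x∈p⇒1≤∣p∣ (x∈p∩q⁺ (proj₂ (meet-next i))))

    two-shared : ∀ i j x → i ≢ j →
      x ∈ₛ c i → x ∈ₛ c (next i) → x ∈ₛ c j → x ∈ₛ c (next j) → ⊥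
    two-shared i j x i≢j x∈cᵢ x∈cₙᵢ x∈cⱼ x∈cₙⱼ with next i ≟ᶠ j
    ... | no nᵢ≢j = triangle-free i (next i) j x (i≢nᵢ i) nᵢ≢j i≢j x∈cᵢ x∈cₙᵢ x∈cⱼ
    ... | yes refl = triangle-free i (next i) (next (next i)) x (i≢nᵢ i) (i≢nᵢ (next i))
                       (next∘next≢id 2≤m i ∘ sym) x∈cᵢ x∈cₙᵢ x∈cₙⱼ

    sharedDist : ∀ i j → i ≢ j → ∣ (c i ∩ c (next i)) ∩ (c j ∩ c (next j)) ∣ ≡ 0
    sharedDist i j i≢j = Empty⇒∣p∣≡0 λ { (x , x∈) →
      let x∈cᵢ∩cₙᵢ , x∈cⱼ∩cₙⱼ = x∈p∩q⁻ _ _ x∈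
          x∈cᵢ , x∈cₙᵢ = x∈p∩q⁻ _ _ x∈cᵢ∩cₙᵢ
          x∈cⱼ , x∈cₙⱼ = x∈p∩q⁻ _ _ x∈cⱼ∩cₙⱼ
      in two-shared i j x i≢j x∈cᵢ x∈cₙᵢ x∈cⱼ x∈cₙⱼ }

    nonconsec : ∀ i j → i ≢ j → j ≢ next i → i ≢ next j → ∣ c i ∩ c j ∣ ≡ 0
    nonconsec i j i≢j j≢nᵢ i≢nⱼ = Empty⇒∣p∣≡0 λ { (x , x∈) →
      let x∈cᵢ , x∈cⱼ = x∈p∩q⁻ _ _ x∈ in [ i≢j , [ j≢nᵢ , i≢nⱼ ] ] (adjacent i j x x∈cᵢ x∈cⱼ) }

  looseCycleℕ : 2 ≤ m → (q : ℕ → Subset n) → (∀ a → a ≤ m → q a ∈ edges H) →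
    (∀ a → a < m → Meet (q a) (q (suc a))) → Meet (q m) (q 0) →
    (∀ a b x → a ≤ m → b ≤ m → x ∈ₛ q a → x ∈ₛ q b → CyclicAdjacentℕ m a b) →
    (∀ a b c x → a ≤ m → b ≤ m → c ≤ m → a ≢ b → b ≢ c → a ≢ c →
       x ∈ₛ q a → x ∈ₛ q b → x ∈ₛ q c → ⊥) →
    LooseCycle H m
  looseCycleℕ 2≤m q q∈H meet-suc meet-last adjacent triangle-free =
    looseCycle 2≤m (q ∘ toℕ) (λ i → q∈H (toℕ i) (toℕ≤pred[n] i)) meet-next
      (λ i j x x∈cᵢ x∈cⱼ → CyclicAdjacentℕ⇒CyclicAdjacent
        (adjacent _ _ x (toℕ≤pred[n] i) (toℕ≤pred[n] j) x∈cᵢ x∈cⱼ))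
      (λ i j k x i≢j j≢k i≢k → triangle-free _ _ _ x (toℕ≤pred[n] i) (toℕ≤pred[n] j) (toℕ≤pred[n] k)
        (i≢j ∘ toℕ-injective) (j≢k ∘ toℕ-injective) (i≢k ∘ toℕ-injective))
    where
    meet-next : ∀ i → Meet (q (toℕ i)) (q (toℕ (next i)))
    meet-next i with toℕ-next i
    ... | inj₁ (i<m , nᵢ≡1+i) = subst (λ a → Meet (q (toℕ i)) (q a)) (sym nᵢ≡1+i) (meet-suc (toℕ i) i<m)
    ... | inj₂ (i≡m , nᵢ≡0) = subst₂ (λ a b → Meet (q a) (q b)) (sym i≡m) (sym nᵢ≡0) meet-last

  record IsLoosePath (P : List (Subset n)) : Set where
    field
      inH      : ∀ {e} → e ∈ P → e ∈ edges H
      meet-suc : ∀ a → suc a < length P → Meet (P ‼ a) (P ‼ suc a)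
      adjacent : ∀ a b x → x ∈ₛ P ‼ a → x ∈ₛ P ‼ b → Adjacent a b
  open IsLoosePath

  IsLoosePath-triangle : ∀ {P a b c x} → IsLoosePath P → a ≢ b → b ≢ c → a ≢ c →
    x ∈ₛ P ‼ a → x ∈ₛ P ‼ b → x ∈ₛ P ‼ c → ⊥
  IsLoosePath-triangle {a = a} {b} {c} {x} path a≢b b≢c a≢c x∈a x∈b x∈c = Adjacent-triangle a≢b b≢c a≢c
    (adjacent path a b x x∈a x∈b) (adjacent path b c x x∈b x∈c) (adjacent path a c x x∈a x∈c)

  IsLoosePath-[-] : ∀ {e} → e ∈ edges H → IsLoosePath (e ∷ [])
  IsLoosePath-[-] e∈H = record
    { inH      = λ { (here refl) → e∈H }
    ; meet-suc = λ { _ (s≤s ()) }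
    ; adjacent = λ { zero zero _ _ _ → inj₁ refl
                   ; zero (suc _) _ _ x∈∅ → ⊥-elim (∉⊥ x∈∅)
                   ; (suc _) _ _ x∈∅ _ → ⊥-elim (∉⊥ x∈∅) }
    }

  IsLoosePath-∷ : ∀ {g p₀ T} → IsLoosePath (p₀ ∷ T) → g ∈ edges H → Meet g p₀ →
    (∀ a → ¬ Meet g (T ‼ a)) → IsLoosePath (g ∷ p₀ ∷ T)
  IsLoosePath-∷ {g} {p₀} {T} path g∈H meet disjoint = record
    { inH      = λ { (here refl) → g∈H ; (there e∈P) → inH path e∈P }
    ; meet-suc = λ { zero _ → meet ; (suc a) (s≤s a<∣P∣) → meet-suc path a a<∣P∣ }
    ; adjacent = adjacent′
    }
    where
    adjacent′ : ∀ a b x → x ∈ₛ (g ∷ p₀ ∷ T) ‼ a → x ∈ₛ (g ∷ p₀ ∷ T) ‼ b → Adjacent a b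
    adjacent′ zero zero _ _ _ = inj₁ refl
    adjacent′ zero (suc zero) _ _ _ = inj₂ (inj₁ refl)
    adjacent′ (suc zero) zero _ _ _ = inj₂ (inj₂ refl)
    adjacent′ zero (suc (suc b)) x x∈g x∈t = ⊥-elim (disjoint b (x , x∈g , x∈t))
    adjacent′ (suc (suc a)) zero x x∈t x∈g = ⊥-elim (disjoint a (x , x∈g , x∈t))
    adjacent′ (suc a) (suc b) x x∈a x∈b = Adjacent-suc (adjacent path a b x x∈a x∈b)

  closePath : ∀ {g P k} → 1 ≤ k → k < length P → IsLoosePath P → g ∈ edges H →
    Meet g (P ‼ 0) → Meet (P ‼ k) g →
    (∀ c x → c ≤ k → x ∈ₛ g → x ∈ₛ P ‼ c → c ≡ 0 ⊎ c ≡ k) →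
    (∀ x → x ∈ₛ g → x ∈ₛ P ‼ 0 → x ∈ₛ P ‼ k → ⊥) →
    HasLooseCycle H
  closePath {g} {P} {k} 1≤k k<∣P∣ path g∈H meet-first meet-last only-ends avoids-corner =
    suc k , looseCycleℕ (s≤s 1≤k) ((g ∷ P) ‼_) q∈H meet-suc′ meet-last adjacent′ triangle-free′
    where
    q∈H : ∀ a → a ≤ suc k → (g ∷ P) ‼ a ∈ edges H
    q∈H zero _ = g∈H
    q∈H (suc a) (s≤s a≤k) = inH path (‼-∈ P a (≤-<-trans a≤k k<∣P∣))

    meet-suc′ : ∀ a → a < suc k → Meet ((g ∷ P) ‼ a) ((g ∷ P) ‼ suc a)
    meet-suc′ zero _ = meet-first
    meet-suc′ (suc a) (s≤s a<k) = meet-suc path a (≤-trans (s≤s a<k) k<∣P∣)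

    g-adjacent : ∀ c x → c ≤ k → x ∈ₛ g → x ∈ₛ P ‼ c → CyclicAdjacentℕ (suc k) 0 (suc c)
    g-adjacent c x c≤k x∈g x∈c with only-ends c x c≤k x∈g x∈c
    ... | inj₁ refl = inj₁ (inj₂ (inj₁ refl))
    ... | inj₂ refl = inj₂ (inj₁ (refl , refl))

    adjacent′ : ∀ a b x → a ≤ suc k → b ≤ suc k →
      x ∈ₛ (g ∷ P) ‼ a → x ∈ₛ (g ∷ P) ‼ b → CyclicAdjacentℕ (suc k) a b
    adjacent′ zero zero _ _ _ _ _ = inj₁ (inj₁ refl)
    adjacent′ zero (suc c) x _ (s≤s c≤k) x∈g x∈c = g-adjacent c x c≤k x∈g x∈c
    adjacent′ (suc c) zero x (s≤s c≤k) _ x∈c x∈g = CyclicAdjacentℕ-sym (g-adjacent c x c≤k x∈g x∈c)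
    adjacent′ (suc a) (suc b) x _ _ x∈a x∈b = inj₁ (Adjacent-suc (adjacent path a b x x∈a x∈b))

    g-triangle : ∀ b c x → b ≢ c → b ≤ k → c ≤ k → x ∈ₛ g → x ∈ₛ P ‼ b → x ∈ₛ P ‼ c → ⊥
    g-triangle b c x b≢c b≤k c≤k x∈g x∈b x∈c
      with only-ends b x b≤k x∈g x∈b | only-ends c x c≤k x∈g x∈c
    ... | inj₁ refl | inj₁ refl = b≢c refl
    ... | inj₂ refl | inj₂ refl = b≢c refl
    ... | inj₁ refl | inj₂ refl = avoids-corner x x∈g x∈b x∈c
    ... | inj₂ refl | inj₁ refl = avoids-corner x x∈g x∈c x∈b

    triangle-free′ : ∀ a b c x → a ≤ suc k → b ≤ suc k → c ≤ suc k → a ≢ b → b ≢ c → a ≢ c →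
      x ∈ₛ (g ∷ P) ‼ a → x ∈ₛ (g ∷ P) ‼ b → x ∈ₛ (g ∷ P) ‼ c → ⊥
    triangle-free′ zero zero _ _ _ _ _ a≢b _ _ _ _ _ = a≢b refl
    triangle-free′ zero (suc _) zero _ _ _ _ _ _ a≢c _ _ _ = a≢c refl
    triangle-free′ (suc _) zero zero _ _ _ _ _ b≢c _ _ _ _ = b≢c refl
    triangle-free′ zero (suc b) (suc c) x _ (s≤s b≤k) (s≤s c≤k) _ b≢c _ x∈g x∈b x∈c =
      g-triangle b c x (b≢c ∘ cong suc) b≤k c≤k x∈g x∈b x∈c
    triangle-free′ (suc a) zero (suc c) x (s≤s a≤k) _ (s≤s c≤k) _ _ a≢c x∈a x∈g x∈c =
      g-triangle a c x (a≢c ∘ cong suc) a≤k c≤k x∈g x∈a x∈c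
    triangle-free′ (suc a) (suc b) zero x (s≤s a≤k) (s≤s b≤k) _ a≢b _ _ x∈a x∈b x∈g =
      g-triangle a b x (a≢b ∘ cong suc) a≤k b≤k x∈g x∈a x∈b
    triangle-free′ (suc a) (suc b) (suc c) x _ _ _ a≢b b≢c a≢c x∈a x∈b x∈c =
      IsLoosePath-triangle path (a≢b ∘ cong suc) (b≢c ∘ cong suc) (a≢c ∘ cong suc) x∈a x∈b x∈c

  closeAtFirstMeeting : ∀ {g p₀ T x a} → IsLoosePath (p₀ ∷ T) → g ∈ edges H → g ≢ p₀ →
    x ∈ₛ g → x ∈ₛ p₀ → x ∉ₛ T ‼ 0 →
    Meet g (T ‼ a) → (∀ b → b < a → ¬ Meet g (T ‼ b)) → HasLooseCycle H
  closeAtFirstMeeting {g} {p₀} {T} {x} {a} path g∈H g≢p₀ x∈g x∈p₀ x∉t₀ (w , w∈g , w∈tₐ) before =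
    closePath (s≤s z≤n) (s≤s (‼-< T a w∈tₐ)) path g∈H (x , x∈g , x∈p₀) (w , w∈tₐ , w∈g)
      only-ends avoids-corner
    where
    only-ends : ∀ c v → c ≤ suc a → v ∈ₛ g → v ∈ₛ (p₀ ∷ T) ‼ c → c ≡ 0 ⊎ c ≡ suc a
    only-ends zero _ _ _ _ = inj₁ refl
    only-ends (suc c) v (s≤s c≤a) v∈g v∈c with m≤n⇒m<n∨m≡n c≤a
    ... | inj₁ c<a = ⊥-elim (before c c<a (v , v∈g , v∈c))
    ... | inj₂ c≡a = inj₂ (cong suc c≡a)

    -- A vertex of p₀ ∩ tₐ forces a = 0; if it is also in g it is x by linearity, and x ∉ t₀.
    avoids-corner : ∀ v → v ∈ₛ g → v ∈ₛ p₀ → v ∈ₛ T ‼ a → ⊥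
    avoids-corner v v∈g v∈p₀ v∈tₐ with adjacent path 0 (suc a) v v∈p₀ v∈tₐ
    ... | inj₁ ()
    ... | inj₂ (inj₂ ())
    ... | inj₂ (inj₁ refl) =
          x∉t₀ (subst (_∈ₛ T ‼ 0) v≡x v∈tₐ)
      where
      v≡x : v ≡ x
      v≡x = shared-vertex-unique g∈H (inH path (here refl)) g≢p₀ v∈g v∈p₀ x∈g x∈p₀

  module _ {L : List (Subset n)} (L⊆H : ∀ {e} → e ∈ L → e ∈ edges H)
           (no-pendant : NoPendantVertex L) where

    -- Every extension adds a vertex to ⋃ P ⊆ Fin n, so the fuel never runs out.
    grow : ∀ (fuel : ℕ) {p₀ T x} → IsLoosePath (p₀ ∷ T) → p₀ ∈ L → x ∈ₛ p₀ → x ∉ₛ T ‼ 0 →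
           n < ∣ ⋃ (p₀ ∷ T) ∣ + fuel → HasLooseCycle H
    grow zero {p₀} {T} _ _ _ _ n<∣⋃P∣+0 =
      contradiction (∣p∣≤n (⋃ (p₀ ∷ T))) (<⇒≱ (subst (n <_) (+-identityʳ _) n<∣⋃P∣+0))
    grow (suc fuel) {p₀} {T} {x} path p₀∈L x∈p₀ x∉t₀ n<∣⋃P∣+1+fuel
      with find (no-pendant p₀∈L x∈p₀)
    ... | g , g∈L , g≢p₀ , x∈g with firstMeeting g T
    ...   | inj₂ (_ , meet , before) =
            closeAtFirstMeeting path (L⊆H g∈L) g≢p₀ x∈g x∈p₀ x∉t₀ meet before
    ...   | inj₁ disjoint =
            let y , y∈g , y∉p₀ = private-vertex (L⊆H g∈L) (L⊆H p₀∈L) g≢p₀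
                y∉⋃P : y ∉ₛ ⋃ (p₀ ∷ T)
                y∉⋃P y∈⋃P = case ∈-⋃⁻ (p₀ ∷ T) y∈⋃P of λ
                  { (zero , y∈p₀) → y∉p₀ y∈p₀
                  ; (suc a , y∈tₐ) → disjoint a (y , y∈g , y∈tₐ) }
            in grow fuel (IsLoosePath-∷ path (L⊆H g∈L) (x , x∈g , x∈p₀) disjoint) g∈L y∈g y∉p₀
                 (<-≤-trans (subst (n <_) (+-suc _ fuel) n<∣⋃P∣+1+fuel)
                            (+-monoˡ-≤ fuel (∣q∣<∣p∪q∣ y∈g y∉⋃P)))

    NoPendantVertex⇒HasLooseCycle : ∀ {e} → e ∈ L → HasLooseCycle H
    NoPendantVertex⇒HasLooseCycle e∈L =
      let x , x∈e = 1≤∣p∣⇒Nonempty (subst (1 ≤_) (sym (∣e∣≡3 (L⊆H e∈L))) (s≤s z≤n))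
      in grow (suc n) (IsLoosePath-[-] (L⊆H e∈L)) e∈L x∈e ∉⊥ (m≤n+m (suc n) _)

  ∣⋃L∣<∣L∣⇒HasLooseCycle : ∀ {L} → (∀ {e} → e ∈ L → e ∈ edges H) → Unique L →
    ∣ ⋃ L ∣ < length L → HasLooseCycle H
  ∣⋃L∣<∣L∣⇒HasLooseCycle = prune _ refl
    where
    prune : ∀ k {L} → length L ≡ k → (∀ {e} → e ∈ L → e ∈ edges H) → Unique L →
      ∣ ⋃ L ∣ < length L → HasLooseCycle H
    prune _ {[]} _ _ _ ()
    prune zero {_ ∷ _} ()
    prune (suc k) {L@(_ ∷ _)} ∣L∣≡1+k L⊆H unique ∣⋃L∣<∣L∣ with pendantVertex? L
    ... | inj₁ no-pendant = NoPendantVertex⇒HasLooseCycle L⊆H no-pendant (here refl)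
    ... | inj₂ (e , x , e∈L , x∈e , lonely) =
          prune k (suc-injective (trans (sym (length-without unique e∈L)) ∣L∣≡1+k))
            (L⊆H ∘ proj₁ ∘ ∈-without⁻ L) (Unique.filter⁺ (≢? e) unique)
            (<-≤-trans (p⊂q⇒∣p∣<∣q∣ (⋃-without-⊂ e∈L x∈e lonely))
                       (≤-pred (subst (∣ ⋃ L ∣ <_) (length-without unique e∈L) ∣⋃L∣<∣L∣)))

  n<∣E∣⇒HasLooseCycle : n < numEdges H → HasLooseCycle H
  n<∣E∣⇒HasLooseCycle n<∣E∣ =
    ∣⋃L∣<∣L∣⇒HasLooseCycle (λ e∈H → e∈H) (unique H) (≤-<-trans (∣p∣≤n (⋃ (edges H))) n<∣E∣)

EdgeBound⇒288n≤E : ∀ {n E} → 1 ≤ n → EdgeBound n E → 288 * n ≤ E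
EdgeBound⇒288n≤E {n} {E} 1≤n bound = ≮⇒≥ λ E<288n →
  <⇒≱ (bound 1 1 ≤-refl (subst₂ _<_ (sym (*-identityʳ E)) (sym (*-identityʳ (288 * n))) E<288n))
      (≤-trans (s≤s (s≤s z≤n)) (≤-trans (*-monoʳ-≤ 5 1≤n) (≤-reflexive (sym (^-identityʳ (5 * n))))))

corollary1p2 : (n : ℕ) → 1 ≤ n → (H : Hypergraph3 n) → Linear H →
    EdgeBound n (numEdges H) → HasLooseCycle H
corollary1p2 n 1≤n H linear bound = n<∣E∣⇒HasLooseCycle H linear
  (<-≤-trans (subst (n <_) (*-comm n 288) (m<m*n n 288 {{>-nonZero 1≤n}} (s≤s (s≤s z≤n))))
             (EdgeBound⇒288n≤E 1≤n bound))
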